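{- Let $t$ be a $\beta$-normal $\lambda$-term and $v$ a closed $\lambda$-term. Let $\alpha$, $x_1,\dots,x_r$ and $y_{ij}$ ($1\le i\le r$, $1\le j\le n_i$) be variables with $\alpha$ distinct from all $y_{ij}$. If $t[\lambda y_{11}\dots\lambda y_{1n_1}\alpha/x_1,\dots,\lambda y_{r1}\dots\lambda y_{rn_r}\alpha/x_r]\rightarrow_\beta v$ (simultaneous substitution), then $x_i\notin Fv(t)$ for every $1\le i\le r$.
   Context: $\lambda$-terms are pure $\lambda$-terms; $Fv(t)$ is the set of free variables of $t$; substitution is capture-avoiding; $\rightarrow_\beta$ denotes $\beta$-reduction in zero or more steps. -}

module Defs where

open import Data.Nat using (ℕ; zero; suc; _+_)
open import Data.Product using (∃)
open import Data.Sum using (_⊎_)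
open import Relation.Nullary using (¬_)
open import Relation.Binary.PropositionalEquality using (_≡_)
open import Relation.Binary.Construct.Closure.ReflexiveTransitive using (Star)

-- Pure λ-terms, de Bruijn indices (variables are natural numbers;
-- α-equivalent named terms are identified, capture-avoidance is built in).
data Term : Set where
  var : ℕ → Term
  app : Term → Term → Term
  lam : Term → Term

ext : (ℕ → ℕ) → ℕ → ℕ
ext ρ zero    = zero
ext ρ (suc k) = suc (ρ k)

rename : (ℕ → ℕ) → Term → Term
rename ρ (var k)   = var (ρ k)
rename ρ (app s u) = app (rename ρ s) (rename ρ u)
rename ρ (lam s)   = lam (rename (ext ρ) s)

exts : (ℕ → Term) → ℕ → Term
exts σ zero    = var zero
exts σ (suc k) = rename suc (σ k)

subst : (ℕ → Term) → Term → Term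
subst σ (var k)   = σ k
subst σ (app s u) = app (subst σ s) (subst σ u)
subst σ (lam s)   = lam (subst (exts σ) s)

sub0 : Term → ℕ → Term
sub0 u zero    = u
sub0 u (suc k) = var k

_[_] : Term → Term → Term
s [ u ] = subst (sub0 u) s

data _⟶β_ : Term → Term → Set where
  β    : ∀ {s u} → app (lam s) u ⟶β (s [ u ])
  appL : ∀ {s s' u} → s ⟶β s' → app s u ⟶β app s' u
  appR : ∀ {s u u'} → u ⟶β u' → app s u ⟶β app s u'
  ξ    : ∀ {s s'} → s ⟶β s' → lam s ⟶β lam s'

_⟶β*_ : Term → Term → Set
_⟶β*_ = Star _⟶β_

BetaNormal : Term → Set
BetaNormal t = ∀ {t'} → ¬ (t ⟶β t')

data _∈Fv_ : ℕ → Term → Set where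
  fvar : ∀ {x} → x ∈Fv var x
  fappL : ∀ {x s u} → x ∈Fv s → x ∈Fv app s u
  fappR : ∀ {x s u} → x ∈Fv u → x ∈Fv app s u
  flam : ∀ {x s} → suc x ∈Fv s → x ∈Fv lam s

Closed : Term → Set
Closed t = ∀ x → ¬ (x ∈Fv t)

-- λy₁…λyₙ.α  with α distinct from the yⱼ: n binders, body the free variable α
-- (under n binders its de Bruijn index is n + α)
lams : ℕ → Term → Term
lams zero    s = s
lams (suc n) s = lam (lams n s)

projTerm : ℕ → ℕ → Term
projTerm n α = lams n (var (n + α))

-- Call α the head of s (HeadIs α s) when s = λ…λ.(α' M₁ … Mₖ),
-- where α' is α shifted past the binders.  Head occurrences are stable under
-- β-reduction: a head applied to arguments is never a redex, and contracting
-- a redex along the spine (λ b) u keeps the head.  The substituted terms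
-- projTerm n α = λy₁…λyₙ.α all have head α, and every other variable is
-- sent to a variable.  If some xᵢ is free in the normal term t, follow the
-- path from the root of t to that occurrence: since t is normal, every
-- application on the path has a variable-headed (neutral) function part,
-- which after substitution is either still neutral or has head α.  This gives
-- a "persistent" occurrence of α in t[σ] (the predicate Persistent), which
-- survives every β-step and hence forces α to be free in v, contradicting
-- that v is closed.
module Submission where

open import Defs
open import Data.Nat using (ℕ; zero; suc; _+_)
open import Data.Nat.Properties using (+-suc; _≟_)
open import Data.Fin using (Fin)
open import Data.Fin.Properties using (any?)
open import Data.Product using (_,_)
open import Data.Sum using (_⊎_; inj₁; inj₂)
open import Relation.Nullary using (¬_; yes; no)
open import Relation.Binary.PropositionalEquality using (_≡_; _≢_; refl; cong; sym)
  renaming (subst to transport)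
open import Relation.Binary.Construct.Closure.ReflexiveTransitive using (ε; _◅_)

data HeadIs : ℕ → Term → Set where
  head-var : ∀ {z} → HeadIs z (var z)
  head-lam : ∀ {z b} → HeadIs (suc z) b → HeadIs z (lam b)
  head-app : ∀ {z s u} → HeadIs z s → HeadIs z (app s u)

HeadIs-rename : ∀ {z s} (ρ : ℕ → ℕ) → HeadIs z s → HeadIs (ρ z) (rename ρ s)
HeadIs-rename ρ head-var     = head-var
HeadIs-rename ρ (head-lam h) = head-lam (HeadIs-rename (ext ρ) h)
HeadIs-rename ρ (head-app h) = head-app (HeadIs-rename ρ h)

HeadIs-subst : ∀ {k m b} (σ : ℕ → Term) → σ k ≡ var m → HeadIs k b → HeadIs m (subst σ b)
HeadIs-subst σ σk≡m head-var rewrite σk≡m = head-var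
HeadIs-subst σ σk≡m (head-lam h) = head-lam (HeadIs-subst (exts σ) (cong (rename suc) σk≡m) h)
HeadIs-subst σ σk≡m (head-app h) = head-app (HeadIs-subst σ σk≡m h)

-- β-reduction preserves the head; contracting (λ b) u re-binds b's head
-- index suc z to z through the substitution sub0 u.
HeadIs-step : ∀ {z s s'} → HeadIs z s → s ⟶β s' → HeadIs z s'
HeadIs-step (head-app (head-lam h)) β = HeadIs-subst (sub0 _) refl h
HeadIs-step (head-app h) (appL s⟶s') = head-app (HeadIs-step h s⟶s')
HeadIs-step (head-app h) (appR _)     = head-app h
HeadIs-step (head-lam h) (ξ s⟶s')    = head-lam (HeadIs-step h s⟶s')

HeadIs-free : ∀ {z s} → HeadIs z s → z ∈Fv s
HeadIs-free head-var     = fvar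
HeadIs-free (head-lam h) = flam (HeadIs-free h)
HeadIs-free (head-app h) = fappL (HeadIs-free h)

HeadIs-lams : ∀ n {z s} → HeadIs (n + z) s → HeadIs z (lams n s)
HeadIs-lams zero    h = h
HeadIs-lams (suc n) {z} {s} h =
  head-lam (HeadIs-lams n (transport (λ k → HeadIs k s) (sym (+-suc n z)) h))

HeadIs-projTerm : ∀ n α → HeadIs α (projTerm n α)
HeadIs-projTerm n α = HeadIs-lams n head-var

data Neutral : Term → Set where
  neutral-var : ∀ {h} → Neutral (var h)
  neutral-app : ∀ {s u} → Neutral s → Neutral (app s u)

-- A neutral term is never a redex, so it stays neutral under reduction.
Neutral-step : ∀ {s s'} → Neutral s → s ⟶β s' → Neutral s'
Neutral-step (neutral-app ()) β
Neutral-step (neutral-app n) (appL s⟶s') = neutral-app (Neutral-step n s⟶s')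
Neutral-step (neutral-app n) (appR _)     = neutral-app n

-- Persistent z s: an occurrence of z in s reached through λs and through
-- applications whose function part is neutral, ending at a subterm with head z.
-- No redex can ever erase such an occurrence.
data Persistent : ℕ → Term → Set where
  at-head : ∀ {z s} → HeadIs z s → Persistent z s
  in-body : ∀ {z b} → Persistent (suc z) b → Persistent z (lam b)
  in-arg  : ∀ {z s u} → Neutral s → Persistent z u → Persistent z (app s u)
  in-fun  : ∀ {z s u} → Neutral s → Persistent z s → Persistent z (app s u)

Persistent-step : ∀ {z s s'} → Persistent z s → s ⟶β s' → Persistent z s'
Persistent-step (at-head h) s⟶s' = at-head (HeadIs-step h s⟶s')
Persistent-step (in-body p) (ξ s⟶s') = in-body (Persistent-step p s⟶s')
Persistent-step (in-arg () p) β
Persistent-step (in-arg n p) (appL s⟶s') = in-arg (Neutral-step n s⟶s') p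
Persistent-step (in-arg n p) (appR u⟶u') = in-arg n (Persistent-step p u⟶u')
Persistent-step (in-fun () p) β
Persistent-step (in-fun n p) (appL s⟶s') = in-fun (Neutral-step n s⟶s') (Persistent-step p s⟶s')
Persistent-step (in-fun n p) (appR _)     = in-fun n p

Persistent-steps : ∀ {z s s'} → Persistent z s → s ⟶β* s' → Persistent z s'
Persistent-steps p ε             = p
Persistent-steps p (s⟶ ◅ ⟶*s') = Persistent-steps (Persistent-step p s⟶) ⟶*s'

Persistent-free : ∀ {z s} → Persistent z s → z ∈Fv s
Persistent-free (at-head h)  = HeadIs-free h
Persistent-free (in-body p)  = flam (Persistent-free p)
Persistent-free (in-arg _ p) = fappR (Persistent-free p)
Persistent-free (in-fun _ p) = fappL (Persistent-free p)

data AdmissibleImage (α : ℕ) (s : Term) : Set where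
  to-var  : ∀ w → s ≡ var w → AdmissibleImage α s
  to-head : HeadIs α s → AdmissibleImage α s

Admissible : ℕ → (ℕ → Term) → Set
Admissible α σ = ∀ y → AdmissibleImage α (σ y)

Admissible-exts : ∀ {α} (σ : ℕ → Term) → Admissible α σ → Admissible (suc α) (exts σ)
Admissible-exts σ adm zero = to-var zero refl
Admissible-exts σ adm (suc y) with adm y
... | to-var w σy≡w = to-var (suc w) (cong (rename suc) σy≡w)
... | to-head h = to-head (HeadIs-rename suc h)

-- In a normal application s u the function part s is variable-headed; under an
-- α-admissible substitution it becomes neutral or acquires head α.
spine-subst : ∀ {α} (σ : ℕ → Term) (s u : Term) → BetaNormal (app s u) → Admissible α σ
  → Neutral (subst σ s) ⊎ HeadIs α (subst σ s)
spine-subst σ (var y) u nf adm with adm y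
... | to-var w σy≡w rewrite σy≡w = inj₁ neutral-var
... | to-head h                  = inj₂ h
spine-subst σ (app s₁ s₂) u nf adm with spine-subst σ s₁ s₂ (λ st → nf (appL st)) adm
... | inj₁ n = inj₁ (neutral-app n)
... | inj₂ h = inj₂ (head-app h)
spine-subst σ (lam b) u nf adm with () ← nf β

persistent-subst : ∀ {α y} (σ : ℕ → Term) (t : Term) → BetaNormal t → Admissible α σ
  → HeadIs α (σ y) → y ∈Fv t → Persistent α (subst σ t)
persistent-subst σ (var y) nf adm h fvar = at-head h
persistent-subst σ (lam b) nf adm h (flam y∈b) =
  in-body (persistent-subst (exts σ) b (λ st → nf (ξ st)) (Admissible-exts σ adm)
                            (HeadIs-rename suc h) y∈b)
persistent-subst σ (app s u) nf adm h y∈su with spine-subst σ s u nf adm | y∈su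
... | inj₂ hs | _          = at-head (head-app hs)
... | inj₁ ns | fappL y∈s = in-fun ns (persistent-subst σ s (λ st → nf (appL st)) adm h y∈s)
... | inj₁ ns | fappR y∈u = in-arg ns (persistent-subst σ u (λ st → nf (appR st)) adm h y∈u)

projection-admissible : ∀ {α r} (x : Fin r → ℕ) (n : Fin r → ℕ) (σ : ℕ → Term)
  → (∀ i → σ (x i) ≡ projTerm (n i) α)
  → (∀ y → (∀ i → y ≢ x i) → σ y ≡ var y)
  → Admissible α σ
projection-admissible {α} x n σ σx σy y with any? (λ i → y ≟ x i)
... | yes (i , refl) rewrite σx i = to-head (HeadIs-projTerm (n i) α)
... | no y∉x = to-var y (σy y (λ i y≡xi → y∉x (i , y≡xi)))

lemma2p1p4 : (t v : Term) (α r : ℕ) (x : Fin r → ℕ) (n : Fin r → ℕ)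
    (σ : ℕ → Term)
    → (∀ i → σ (x i) ≡ projTerm (n i) α)
    → (∀ y → (∀ i → y ≢ x i) → σ y ≡ var y)
    → BetaNormal t → Closed v
    → subst σ t ⟶β* v
    → ∀ i → ¬ (x i ∈Fv t)
lemma2p1p4 t v α r x n σ σx σy nf closed t[σ]⟶*v i xi∈t =
  closed α (Persistent-free (Persistent-steps persistent t[σ]⟶*v))
  where
  σxi-headed : HeadIs α (σ (x i))
  σxi-headed rewrite σx i = HeadIs-projTerm (n i) α

  persistent : Persistent α (subst σ t)
  persistent = persistent-subst σ t nf (projection-admissible x n σ σx σy) σxi-headed xi∈t
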